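{- Let $\Delta$ be a 3-colored simplicial complex and let $\Gamma\in\mathcal{C}(\Delta)$. Then: (1) $f_{123}(\Gamma)=f_1(\Delta)f_{23}(\Delta)$ if and only if $\lfloor f_{12}(\Delta)/f_1(\Delta)\rfloor\,\lfloor f_{13}(\Delta)/f_1(\Delta)\rfloor\ge f_{23}(\Delta)$; (2) $f_{123}(\Gamma)=f_2(\Delta)f_{13}(\Delta)$ if and only if $\lfloor f_{12}(\Delta)/f_2(\Delta)\rfloor\,\lfloor f_{23}(\Delta)/f_2(\Delta)\rfloor\ge f_{13}(\Delta)$; (3) $f_{123}(\Gamma)=f_3(\Delta)f_{12}(\Delta)$ if and only if $\lfloor f_{13}(\Delta)/f_3(\Delta)\rfloor\,\lfloor f_{23}(\Delta)/f_3(\Delta)\rfloor\ge f_{12}(\Delta)$.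
   Context: A 3-colored simplicial complex is a finite simplicial complex with a coloring of its vertices by $[3]=\{1,2,3\}$ such that no face contains two vertices of the same color. $f_S(\Delta)$ is the number of faces with color set exactly $S\subseteq[3]$ (written $f_1,f_{12},f_{123}$, etc.; $f_{ij}=f_{\{i,j\}}$). Faces with color set $[3]$ are facets. Complexes are assumed to have $f_S>0$ for all $S$. Vertices of color $i$ are labeled $v^i_1,v^i_2,\dots$. Construction: given $\Delta$, positive integers $g_1,g_2,g_3$ and distinct $p,q\in[3]$, build $\Gamma$ as follows. Start with vertices $v^i_1,\dots,v^i_{g_i}$ for each $i$, every two of distinct colors adjacent. If $f_p(\Delta)>g_p$, add $v^p_{g_p+1}$ and, for each color $c\ne p$, join it to the first $k_c$ present vertices of color $c$, with $k_c$ as large as possible so that the number of edges of color set $\{p,c\}$ does not exceed $f_{pc}(\Delta)$. Then, if $f_q(\Delta)>g_q$, add $v^q_{g_q+1}$ and join it in the same way (the present vertices of color $p$ including $v^p_{g_p+1}$ if added). Faces of $\Gamma$: empty set, vertices, edges, and all triples of pairwise adjacent vertices. Write $g_i(\Gamma),p(\Gamma),q(\Gamma)$ for the parameters. $\mathcal{A}(\Delta)$ is the set of all complexes (with parameters) so constructed that are well defined and satisfy $f_S(\Gamma)\le f_S(\Delta)$ for all $S\ne[3]$. $m(\Delta)=\max\{f_{123}(\Gamma):\Gamma\in\mathcal{A}(\Delta)\}$; $\mathcal{B}(\Delta)=\{\Gamma\in\mathcal{A}(\Delta):f_{123}(\Gamma)=m(\Delta)\}$; $n(\Delta)=\max\{f_{12}(\Gamma)+f_{13}(\Gamma)+f_{23}(\Gamma):\Gamma\in\mathcal{B}(\Delta)\}$;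 $\mathcal{C}(\Delta)=\{\Gamma\in\mathcal{B}(\Delta):f_{12}(\Gamma)+f_{13}(\Gamma)+f_{23}(\Gamma)=n(\Delta)\}$. -}

module Defs where

open import Data.Bool using (Bool; true; false; _∧_; _∨_; if_then_else_; T; not)
open import Data.Nat using (ℕ; zero; suc; _+_; _*_; _∸_; _⊓_; _≤_; _<ᵇ_; _≡ᵇ_)
open import Data.Nat.DivMod using (_/_)
open import Data.Fin using (Fin; zero; suc; toℕ)
open import Data.Fin.Properties using (_≟_)
open import Data.Product using (_×_; _,_)
open import Relation.Nullary using (does; ¬_)
open import Relation.Binary.PropositionalEquality using (_≡_; _≢_)

count : ∀ {n} → (Fin n → Bool) → ℕ
count {zero}  f = 0
count {suc n} f = (if f zero then 1 else 0) + count (λ i → f (suc i))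

sumF : ∀ {n} → (Fin n → ℕ) → ℕ
sumF {zero}  f = 0
sumF {suc n} f = f zero + sumF (λ i → f (suc i))

-- floor division; m / 0 is set to 0 (only ever used with positive divisor)
fdiv : ℕ → ℕ → ℕ
fdiv m zero    = 0
fdiv m (suc n) = m / suc n

-- Since no face contains two vertices
-- of the same color, every face is determined by choosing at most one
-- vertex of each color.  The vertices of color i are v^i_1..v^i_{n_i},
-- encoded as Fin n_i (0-based).  Every vertex is a face; the edges of
-- color set {i,j} are given by a decidable relation eij; the facets
-- (color set [3]) by a decidable ternary relation t, which must be
-- closed downward (every edge of a facet is an edge).  The empty face
-- is always present.

record Complex3 : Set where
  field
    n1 n2 n3 : ℕ
    e12 : Fin n1 → Fin n2 → Bool
    e13 : Fin n1 → Fin n3 → Bool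
    e23 : Fin n2 → Fin n3 → Bool
    t   : Fin n1 → Fin n2 → Fin n3 → Bool
    t-closed : ∀ a b c → T (t a b c) → T (e12 a b) × T (e13 a c) × T (e23 b c)

open Complex3 public

f1 f2 f3 f12 f13 f23 f123 : Complex3 → ℕ
f1 Δ = n1 Δ
f2 Δ = n2 Δ
f3 Δ = n3 Δ
f12 Δ = sumF (λ a → count (λ b → e12 Δ a b))
f13 Δ = sumF (λ a → count (λ c → e13 Δ a c))
f23 Δ = sumF (λ b → count (λ c → e23 Δ b c))
f123 Δ = sumF (λ a → sumF (λ b → count (λ c → t Δ a b c)))

-- standing assumption: f_S(Δ) > 0 for all S ⊆ [3]
-- (f_∅ = 1 always)
AllPositive : Complex3 → Set
AllPositive Δ = (1 ≤ f1 Δ) × (1 ≤ f2 Δ) × (1 ≤ f3 Δ)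
              × (1 ≤ f12 Δ) × (1 ≤ f13 Δ) × (1 ≤ f23 Δ) × (1 ≤ f123 Δ)

c1 c2 c3 : Fin 3
c1 = zero
c2 = suc zero
c3 = suc (suc zero)

_==_ : Fin 3 → Fin 3 → Bool
i == j = does (i ≟ j)

-- f_i(Δ) and f_{ij}(Δ) indexed by colors (diagonal unused, set to 0)
fV : Complex3 → Fin 3 → ℕ
fV Δ zero = f1 Δ
fV Δ (suc zero) = f2 Δ
fV Δ (suc (suc zero)) = f3 Δ

fE : Complex3 → Fin 3 → Fin 3 → ℕ
fE Δ zero (suc zero) = f12 Δ
fE Δ (suc zero) zero = f12 Δ
fE Δ zero (suc (suc zero)) = f13 Δ
fE Δ (suc (suc zero)) zero = f13 Δ
fE Δ (suc zero) (suc (suc zero)) = f23 Δ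
fE Δ (suc (suc zero)) (suc zero) = f23 Δ
fE Δ _ _ = 0

record Params : Set where
  constructor params
  field
    g : Fin 3 → ℕ
    p q : Fin 3

open Params public

module Construction (Δ : Complex3) (π : Params) where
  -- is v^p_{g_p+1} added?
  P : Bool
  P = g π (p π) <ᵇ fV Δ (p π)
  -- is v^q_{g_q+1} added?
  Q : Bool
  Q = g π (q π) <ᵇ fV Δ (q π)

  -- number of color-c vertices joined to v^p_{g_p+1} (c ≠ p): the largest
  -- k ≤ g_c with g_p g_c + k ≤ f_{pc}(Δ)  (see wdP for well-definedness)
  kP : Fin 3 → ℕ
  kP c = g π c ⊓ (fE Δ (p π) c ∸ g π (p π) * g π c)

  -- number of present color-c vertices when v^q_{g_q+1} is added
  presQ : Fin 3 → ℕ
  presQ c = g π c + (if (c == p π) ∧ P then 1 else 0)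

  -- number of edges of color set {q,c} present before v^q_{g_q+1} is added
  edgesQ : Fin 3 → ℕ
  edgesQ c = g π (q π) * g π c + (if (c == p π) ∧ P then kP (q π) else 0)

  -- number of color-c vertices joined to v^q_{g_q+1} (c ≠ q)
  kQ : Fin 3 → ℕ
  kQ c = presQ c ⊓ (fE Δ (q π) c ∸ edgesQ c)

  nΓ : Fin 3 → ℕ
  nΓ i = g π i + (if (i == p π) ∧ P then 1 else 0)
               + (if (i == q π) ∧ Q then 1 else 0)

  -- adjacency of vertex with 0-based index a of color i and vertex with
  -- 0-based index b of color j (i ≠ j)
  base : Fin 3 → Fin 3 → ℕ → ℕ → Bool
  base i j a b = (a <ᵇ g π i) ∧ (b <ᵇ g π j)

  pEdge : Fin 3 → Fin 3 → ℕ → ℕ → Bool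
  pEdge i j a b = P ∧ (i == p π) ∧ (a ≡ᵇ g π (p π)) ∧ (b <ᵇ kP j)

  qEdge : Fin 3 → Fin 3 → ℕ → ℕ → Bool
  qEdge i j a b = Q ∧ (i == q π) ∧ (a ≡ᵇ g π (q π)) ∧ (b <ᵇ kQ j)

  adj : Fin 3 → Fin 3 → ℕ → ℕ → Bool
  adj i j a b = base i j a b ∨ pEdge i j a b ∨ pEdge j i b a
                ∨ qEdge i j a b ∨ qEdge j i b a

  private
    split3 : ∀ x y z → T (x ∧ y ∧ z) → T x × T y × T z
    split3 true true true _ = _ , _ , _

  Γ : Complex3
  Γ = record
    { n1 = nΓ c1 ; n2 = nΓ c2 ; n3 = nΓ c3
    ; e12 = λ a b → adj c1 c2 (toℕ a) (toℕ b)
    ; e13 = λ a c → adj c1 c3 (toℕ a) (toℕ c)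
    ; e23 = λ b c → adj c2 c3 (toℕ b) (toℕ c)
    ; t = λ a b c → adj c1 c2 (toℕ a) (toℕ b) ∧ adj c1 c3 (toℕ a) (toℕ c)
                    ∧ adj c2 c3 (toℕ b) (toℕ c)
    ; t-closed = λ a b c → split3 _ _ _
    }

  -- the construction is well defined: the "largest k" exists, i.e. the
  -- edge counts before adding the new vertex do not already exceed f_{pc}(Δ)
  WellDefined : Set
  WellDefined = (T P → ∀ c → c ≢ p π → g π (p π) * g π c ≤ fE Δ (p π) c)
              × (T Q → ∀ c → c ≢ q π → edgesQ c ≤ fE Δ (q π) c)

  InA : Set
  InA = (∀ i → 1 ≤ g π i) × (p π ≢ q π) × WellDefined
      × (f1 Γ ≤ f1 Δ) × (f2 Γ ≤ f2 Δ) × (f3 Γ ≤ f3 Δ)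
      × (f12 Γ ≤ f12 Δ) × (f13 Γ ≤ f13 Δ) × (f23 Γ ≤ f23 Δ)

  edgeSum : ℕ
  edgeSum = f12 Γ + f13 Γ + f23 Γ

open Construction public using (Γ; InA; edgeSum)

InB : Complex3 → Params → Set
InB Δ π = InA Δ π × (∀ π' → InA Δ π' → f123 (Γ Δ π') ≤ f123 (Γ Δ π))

InC : Complex3 → Params → Set
InC Δ π = InB Δ π × (∀ π' → InB Δ π' → edgeSum Δ π' ≤ edgeSum Δ π)

-- Every facet is a color-1 vertex together with a 23-edge, so for Γ ∈ 𝒜(Δ)
-- f₁₂₃(Γ) ≤ f₁(Γ) f₂₃(Γ) ≤ f₁(Δ) f₂₃(Δ).  In case of equality every color-1 vertex
-- spans a facet with every 23-edge, so the 23-edges embed into N(a) × N(a′) for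
-- color-1 vertices a, a′ of least 12- and 13-degree; these degrees are at most
-- ⌊f₁₂/f₁⌋ and ⌊f₁₃/f₁⌋.  Conversely, if f₂₃ ≤ ⌊f₁₂/f₁⌋ ⌊f₁₃/f₁⌋, write
-- f₂₃ = rows · width + rest with width ≤ ⌊f₁₂/f₁⌋, rows ≤ ⌊f₁₃/f₁⌋ and rest < width:
-- the construction with g = (f₁, width, rows), p = 3, q = 1 (no color-1 vertex is
-- added) lies in 𝒜(Δ) and has f₁ · rows · width facets in its complete part and
-- f₁ · rest through v³_{rows+1}, so the maximality of Γ forces equality.  Parts (2)
-- and (3) follow by relabeling the colors of Γ; only the construction is redone
-- for each color.

module Submission where

open import Defs
open import Data.Bool using (Bool; true; false; _∧_; _∨_; if_then_else_; T)
open import Data.Bool.Properties using (T-∧; T-∨; T-≡; ∧-zeroʳ)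
open import Data.Nat using (ℕ; zero; suc; _+_; _*_; _∸_; _⊓_; _≤_; _<_; _<ᵇ_; _≡ᵇ_; z≤n; s≤s; NonZero; >-nonZero)
open import Data.Nat.Properties
open import Data.Nat.DivMod using (_/_; _%_; m*n/n≡m; /-monoˡ-≤; m/n*n≤m; m≡m%n+[m/n]*n; m%n<n; m≥n⇒m/n>0)
open import Data.Fin using (Fin; zero; suc; toℕ)
open import Data.Product using (Σ; ∃₂; _×_; _,_; proj₁; proj₂)
open import Data.Empty using (⊥; ⊥-elim)
open import Data.Sum using (_⊎_; inj₁; inj₂)
open import Relation.Nullary using (yes; no)
open import Relation.Binary.PropositionalEquality
open import Function.Bundles using (Equivalence; _⇔_; mk⇔)
open import Algebra.Properties.CommutativeSemigroup +-commutativeSemigroup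
  using () renaming (interchange to +-interchange)
open import Algebra.Properties.CommutativeSemigroup *-commutativeSemigroup
  using (x∙yz≈y∙xz; x∙yz≈z∙xy; x∙yz≈y∙zx)

open Equivalence using (to; from)

𝟙 : Bool → ℕ
𝟙 b = if b then 1 else 0

𝟙-∧ : ∀ x y → 𝟙 (x ∧ y) ≡ 𝟙 x * 𝟙 y
𝟙-∧ true  y = sym (+-identityʳ (𝟙 y))
𝟙-∧ false y = refl

𝟙-∨ : ∀ x y → 𝟙 (x ∨ y) ≤ 𝟙 x + 𝟙 y
𝟙-∨ true  y = s≤s z≤n
𝟙-∨ false y = ≤-refl

𝟙-mono : ∀ {x y} → (T x → T y) → 𝟙 x ≤ 𝟙 y
𝟙-mono {true}  {true}  _ = ≤-refl
𝟙-mono {true}  {false} f = ⊥-elim (f _)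
𝟙-mono {false}         _ = z≤n

sumF-cong : ∀ {n} {f g : Fin n → ℕ} → (∀ i → f i ≡ g i) → sumF f ≡ sumF g
sumF-cong {zero}  e = refl
sumF-cong {suc n} e = cong₂ _+_ (e zero) (sumF-cong (λ i → e (suc i)))

sumF-mono : ∀ {n} {f g : Fin n → ℕ} → (∀ i → f i ≤ g i) → sumF f ≤ sumF g
sumF-mono {zero}  le = z≤n
sumF-mono {suc n} le = +-mono-≤ (le zero) (sumF-mono (λ i → le (suc i)))

sumF-const : ∀ n k → sumF {n} (λ _ → k) ≡ n * k
sumF-const zero    k = refl
sumF-const (suc n) k = cong (k +_) (sumF-const n k)

sumF-+ : ∀ {n} (f g : Fin n → ℕ) → sumF (λ i → f i + g i) ≡ sumF f + sumF g
sumF-+ {zero}  f g = refl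
sumF-+ {suc n} f g =
  trans (cong (f zero + g zero +_) (sumF-+ (λ i → f (suc i)) (λ i → g (suc i))))
        (+-interchange (f zero) (g zero) _ _)

sumF-*ˡ : ∀ {n} k (f : Fin n → ℕ) → sumF (λ i → k * f i) ≡ k * sumF f
sumF-*ˡ {zero}  k f = sym (*-zeroʳ k)
sumF-*ˡ {suc n} k f =
  trans (cong (k * f zero +_) (sumF-*ˡ k (λ i → f (suc i)))) (sym (*-distribˡ-+ k (f zero) _))

sumF-*ʳ : ∀ {n} k (f : Fin n → ℕ) → sumF (λ i → f i * k) ≡ sumF f * k
sumF-*ʳ k f = trans (sumF-cong (λ i → *-comm (f i) k)) (trans (sumF-*ˡ k f) (*-comm k _))

sumF-swap : ∀ {n m} (h : Fin n → Fin m → ℕ) →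
            sumF (λ a → sumF (λ b → h a b)) ≡ sumF (λ b → sumF (λ a → h a b))
sumF-swap {zero}  {m} h = sym (trans (sumF-const m 0) (*-zeroʳ m))
sumF-swap {suc n} h =
  trans (cong (sumF (h zero) +_) (sumF-swap (λ a b → h (suc a) b)))
        (sym (sumF-+ (h zero) (λ b → sumF (λ a → h (suc a) b))))

sumF-tight : ∀ {n} {f g : Fin n → ℕ} → (∀ i → f i ≤ g i) → sumF g ≤ sumF f → ∀ i → g i ≤ f i
sumF-tight {suc n} {f} {g} le tot zero =
  +-cancelʳ-≤ (sumF (λ i → f (suc i))) (g zero) (f zero)
    (≤-trans (+-monoʳ-≤ (g zero) (sumF-mono (λ i → le (suc i)))) tot)
sumF-tight {suc n} {f} {g} le tot (suc i) =
  sumF-tight (λ j → le (suc j)) (+-cancelˡ-≤ (g zero) _ _ (≤-trans tot (+-monoˡ-≤ _ (le zero)))) i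

argmin : ∀ {n} (h : Fin (suc n) → ℕ) → Σ (Fin (suc n)) (λ i → ∀ j → h i ≤ h j)
argmin {zero}  h = zero , λ { zero → ≤-refl }
argmin {suc n} h with argmin (λ i → h (suc i))
... | i , hi with h zero ≤? h (suc i)
...   | yes z≤i = zero , λ { zero → ≤-refl ; (suc j) → ≤-trans z≤i (hi j) }
...   | no  z≰i = suc i , λ { zero → <⇒≤ (≰⇒> z≰i) ; (suc j) → hi j }

∃-≤-average : ∀ {n} → 1 ≤ n → (h : Fin n → ℕ) → Σ (Fin n) (λ i → n * h i ≤ sumF h)
∃-≤-average {suc n} _ h with argmin h
... | i , min = i , subst (_≤ sumF h) (sumF-const (suc n) (h i)) (sumF-mono min)

count≡sumF : ∀ {n} (f : Fin n → Bool) → count f ≡ sumF (λ i → 𝟙 (f i))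
count≡sumF {zero}  f = refl
count≡sumF {suc n} f = cong (𝟙 (f zero) +_) (count≡sumF (λ i → f (suc i)))

count-mono : ∀ {n} {f g : Fin n → Bool} → (∀ i → T (f i) → T (g i)) → count f ≤ count g
count-mono {f = f} {g} f⇒g =
  subst₂ _≤_ (sym (count≡sumF f)) (sym (count≡sumF g)) (sumF-mono (λ i → 𝟙-mono (f⇒g i)))

count-tight : ∀ {n} {f g : Fin n → Bool} → (∀ i → T (f i) → T (g i)) → count g ≤ count f →
              ∀ i → T (g i) → T (f i)
count-tight {f = f} {g} f⇒g g≤f i gi with f i | g i
  | sumF-tight (λ j → 𝟙-mono (f⇒g j))
      (subst₂ _≤_ (count≡sumF g) (count≡sumF f) g≤f) i
... | true  | _    | _  = _
... | false | true | ()

count≤n : ∀ {n} (f : Fin n → Bool) → count f ≤ n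
count≤n {zero}  f = z≤n
count≤n {suc n} f = +-mono-≤ (𝟙≤1 (f zero)) (count≤n (λ i → f (suc i)))
  where
  𝟙≤1 : ∀ b → 𝟙 b ≤ 1
  𝟙≤1 true  = ≤-refl
  𝟙≤1 false = z≤n

count-false : ∀ n → count {n} (λ _ → false) ≡ 0
count-false zero    = refl
count-false (suc n) = count-false n

count-∧ˡ : ∀ {n} x (f : Fin n → Bool) → count (λ i → x ∧ f i) ≡ 𝟙 x * count f
count-∧ˡ     true  f = sym (+-identityʳ (count f))
count-∧ˡ {n} false f = count-false n

count-∧-T : ∀ {n x} {f : Fin n → Bool} → T x → count (λ i → x ∧ f i) ≡ count f
count-∧-T {x = true} _ = refl

count-<ᵇ : ∀ n k → count {n} (λ i → toℕ i <ᵇ k) ≡ n ⊓ k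
count-<ᵇ zero    k       = refl
count-<ᵇ (suc n) zero    = count-false n
count-<ᵇ (suc n) (suc k) = cong suc (count-<ᵇ n k)

count-≡ᵇ≤1 : ∀ n k → count {n} (λ i → toℕ i ≡ᵇ k) ≤ 1
count-≡ᵇ≤1 zero    k       = z≤n
count-≡ᵇ≤1 (suc n) zero    = s≤s (≤-reflexive (count-false n))
count-≡ᵇ≤1 (suc n) (suc k) = count-≡ᵇ≤1 n k

count-≡ᵇ≥1 : ∀ n k → k < n → 1 ≤ count {n} (λ i → toℕ i ≡ᵇ k)
count-≡ᵇ≥1 (suc n) zero    _         = s≤s z≤n
count-≡ᵇ≥1 (suc n) (suc k) (s≤s k<n) = count-≡ᵇ≥1 n k k<n

sumF-𝟙-* : ∀ {n} (f : Fin n → Bool) k → sumF (λ i → 𝟙 (f i) * k) ≡ count f * k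
sumF-𝟙-* f k = trans (sumF-*ʳ k (λ i → 𝟙 (f i))) (cong (_* k) (sym (count≡sumF f)))

count-disjoint : ∀ {n} {f g h : Fin n → Bool} → (∀ i → T (f i) → T (h i)) → (∀ i → T (g i) → T (h i)) →
                 (∀ i → T (f i) → T (g i) → ⊥) → count f + count g ≤ count h
count-disjoint {f = f} {g} {h} f⇒h g⇒h f∩g = begin
  count f + count g                               ≡⟨ cong₂ _+_ (count≡sumF f) (count≡sumF g) ⟩
  sumF (λ i → 𝟙 (f i)) + sumF (λ i → 𝟙 (g i))     ≡⟨ sym (sumF-+ (λ i → 𝟙 (f i)) (λ i → 𝟙 (g i))) ⟩
  sumF (λ i → 𝟙 (f i) + 𝟙 (g i))                  ≤⟨ sumF-mono (λ i → 𝟙+𝟙≤𝟙 (f⇒h i) (g⇒h i) (f∩g i)) ⟩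
  sumF (λ i → 𝟙 (h i))                            ≡⟨ sym (count≡sumF h) ⟩
  count h                                         ∎
  where
  open ≤-Reasoning
  𝟙+𝟙≤𝟙 : ∀ {x y z} → (T x → T z) → (T y → T z) → (T x → T y → ⊥) → 𝟙 x + 𝟙 y ≤ 𝟙 z
  𝟙+𝟙≤𝟙 {true}  {true}          _   _   x∩y = ⊥-elim (x∩y _ _)
  𝟙+𝟙≤𝟙 {true}  {false}         x⇒z _   _   = 𝟙-mono x⇒z
  𝟙+𝟙≤𝟙 {false} {y}             _   y⇒z _   = 𝟙-mono y⇒z

sumF² : ∀ {n m} → (Fin n → Fin m → ℕ) → ℕ
sumF² h = sumF (λ a → sumF (λ b → h a b))

sumF²-mono : ∀ {n m} {h h′ : Fin n → Fin m → ℕ} → (∀ a b → h a b ≤ h′ a b) → sumF² h ≤ sumF² h′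
sumF²-mono le = sumF-mono (λ a → sumF-mono (le a))

sumF²-+ : ∀ {n m} (h h′ : Fin n → Fin m → ℕ) → sumF² (λ a b → h a b + h′ a b) ≡ sumF² h + sumF² h′
sumF²-+ h h′ = trans (sumF-cong (λ a → sumF-+ (h a) (h′ a))) (sumF-+ (λ a → sumF (h a)) (λ a → sumF (h′ a)))

sumF²-*ˡ : ∀ {n m} k (h : Fin n → Fin m → ℕ) → sumF² (λ a b → k * h a b) ≡ k * sumF² h
sumF²-*ˡ k h = trans (sumF-cong (λ a → sumF-*ˡ k (h a))) (sumF-*ˡ k (λ a → sumF (h a)))

sumF²-𝟙-rect≤ : ∀ {n m} (x : Fin n → Bool) (y : Fin m → Bool) {k l} → count x ≤ k → count y ≤ l →
                sumF² (λ a b → 𝟙 (x a) * 𝟙 (y b)) ≤ k * l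
sumF²-𝟙-rect≤ x y x≤k y≤l = begin
  sumF² (λ a b → 𝟙 (x a) * 𝟙 (y b))
    ≡⟨ sumF-cong (λ a → trans (sumF-*ˡ (𝟙 (x a)) (λ b → 𝟙 (y b))) (cong (𝟙 (x a) *_) (sym (count≡sumF y)))) ⟩
  sumF (λ a → 𝟙 (x a) * count y)
    ≡⟨ sumF-𝟙-* x (count y) ⟩
  count x * count y
    ≤⟨ *-mono-≤ x≤k y≤l ⟩
  _ ∎
  where open ≤-Reasoning

swap₁₂ : Complex3 → Complex3
swap₁₂ K = record
  { n1 = n2 K ; n2 = n1 K ; n3 = n3 K
  ; e12 = λ b a → e12 K a b ; e13 = λ b c → e23 K b c ; e23 = λ a c → e13 K a c
  ; t = λ b a c → t K a b c
  ; t-closed = λ b a c abc → let (ab , ac , bc) = t-closed K a b c abc in ab , bc , ac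
  }

rotate : Complex3 → Complex3
rotate K = record
  { n1 = n3 K ; n2 = n1 K ; n3 = n2 K
  ; e12 = λ c a → e13 K a c ; e13 = λ c b → e23 K b c ; e23 = λ a b → e12 K a b
  ; t = λ c a b → t K a b c
  ; t-closed = λ c a b abc → let (ab , ac , bc) = t-closed K a b c abc in ac , bc , ab
  }

sumF-count-swap : ∀ {n m} (e : Fin n → Fin m → Bool) →
                  sumF (λ a → count (λ b → e a b)) ≡ sumF (λ b → count (λ a → e a b))
sumF-count-swap e = begin
  sumF (λ a → count (λ b → e a b))        ≡⟨ sumF-cong (λ a → count≡sumF (e a)) ⟩
  sumF (λ a → sumF (λ b → 𝟙 (e a b)))     ≡⟨ sumF-swap (λ a b → 𝟙 (e a b)) ⟩
  sumF (λ b → sumF (λ a → 𝟙 (e a b)))     ≡⟨ sumF-cong (λ b → sym (count≡sumF (λ a → e a b))) ⟩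
  sumF (λ b → count (λ a → e a b))        ∎
  where open ≡-Reasoning

f12-swap₁₂ : ∀ K → f12 (swap₁₂ K) ≡ f12 K
f12-swap₁₂ K = sym (sumF-count-swap (e12 K))

f123-swap₁₂ : ∀ K → f123 (swap₁₂ K) ≡ f123 K
f123-swap₁₂ K = sumF-swap (λ b a → count (t K a b))

f12-rotate : ∀ K → f12 (rotate K) ≡ f13 K
f12-rotate K = sym (sumF-count-swap (e13 K))

f13-rotate : ∀ K → f13 (rotate K) ≡ f23 K
f13-rotate K = sym (sumF-count-swap (e23 K))

f123-rotate : ∀ K → f123 (rotate K) ≡ f123 K
f123-rotate K = begin
  sumF (λ c → sumF (λ a → count (λ b → t K a b c)))  ≡⟨ sumF-swap (λ c a → count (λ b → t K a b c)) ⟩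
  sumF (λ a → sumF (λ c → count (λ b → t K a b c)))  ≡⟨ sumF-cong (λ a → sumF-count-swap (λ c b → t K a b c)) ⟩
  sumF (λ a → sumF (λ b → count (λ c → t K a b c)))  ∎
  where open ≡-Reasoning

sumF-count≤ : ∀ {n m} (e : Fin n → Fin m → Bool) → sumF (λ a → count (e a)) ≤ n * m
sumF-count≤ {n} {m} e = subst (sumF (λ a → count (e a)) ≤_) (sumF-const n m) (sumF-mono (λ a → count≤n (e a)))

f12≤f1*f2 : ∀ K → f12 K ≤ f1 K * f2 K
f12≤f1*f2 K = sumF-count≤ (e12 K)

f13≤f1*f3 : ∀ K → f13 K ≤ f1 K * f3 K
f13≤f1*f3 K = sumF-count≤ (e13 K)

f23≤f2*f3 : ∀ K → f23 K ≤ f2 K * f3 K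
f23≤f2*f3 K = sumF-count≤ (e23 K)

module _ (K : Complex3) where

  link≤f23 : ∀ a → sumF (λ b → count (t K a b)) ≤ f23 K
  link≤f23 a = sumF-mono (λ b → count-mono (λ c abc → proj₂ (proj₂ (t-closed K a b c abc))))

  f123≤f1*f23 : f123 K ≤ f1 K * f23 K
  f123≤f1*f23 = subst (f123 K ≤_) (sumF-const (n1 K) (f23 K)) (sumF-mono link≤f23)

  f1*f23≤f123⇒degrees : 1 ≤ f1 K → f1 K * f23 K ≤ f123 K →
    ∃₂ λ d₁₂ d₁₃ → f1 K * d₁₂ ≤ f12 K × f1 K * d₁₃ ≤ f13 K × f23 K ≤ d₁₂ * d₁₃
  f1*f23≤f123⇒degrees n1>0 tight =
    count (e12 K a₂) , count (e13 K a₃) , proj₂ least₁₂ , proj₂ least₁₃ , f23≤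
    where
    least₁₂ : Σ (Fin (n1 K)) (λ a → f1 K * count (e12 K a) ≤ f12 K)
    least₁₂ = ∃-≤-average n1>0 (λ a → count (e12 K a))
    least₁₃ : Σ (Fin (n1 K)) (λ a → f1 K * count (e13 K a) ≤ f13 K)
    least₁₃ = ∃-≤-average n1>0 (λ a → count (e13 K a))
    a₂ a₃ : Fin (n1 K)
    a₂ = proj₁ least₁₂
    a₃ = proj₁ least₁₃

    e23⇒t : ∀ a b c → T (e23 K b c) → T (t K a b c)
    e23⇒t a b c =
      count-tight (λ c′ abc′ → proj₂ (proj₂ (t-closed K a b c′ abc′)))
        (sumF-tight (λ b′ → count-mono (λ c′ abc′ → proj₂ (proj₂ (t-closed K a b′ c′ abc′))))
           (sumF-tight link≤f23 (subst (_≤ f123 K) (sym (sumF-const (n1 K) (f23 K))) tight) a) b)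
        c

    f23≤ : f23 K ≤ count (e12 K a₂) * count (e13 K a₃)
    f23≤ = begin
      f23 K
        ≤⟨ sumF-mono (λ b → count-mono (λ c bc → from T-∧
             (proj₁ (t-closed K a₂ b c (e23⇒t a₂ b c bc)) , proj₁ (proj₂ (t-closed K a₃ b c (e23⇒t a₃ b c bc)))))) ⟩
      sumF (λ b → count (λ c → e12 K a₂ b ∧ e13 K a₃ c))
        ≡⟨ sumF-cong (λ b → count-∧ˡ (e12 K a₂ b) (e13 K a₃)) ⟩
      sumF (λ b → 𝟙 (e12 K a₂ b) * count (e13 K a₃))
        ≡⟨ sumF-𝟙-* (e12 K a₂) (count (e13 K a₃)) ⟩
      count (e12 K a₂) * count (e13 K a₃) ∎
      where open ≤-Reasoning

  count-box : (x : Fin (n1 K) → Bool) (y : Fin (n2 K) → Bool) (z : Fin (n3 K) → Bool) →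
              sumF² (λ a b → count (λ c → x a ∧ (y b ∧ z c))) ≡ count x * (count y * count z)
  count-box x y z = begin
    sumF² (λ a b → count (λ c → x a ∧ (y b ∧ z c)))
      ≡⟨ sumF-cong (λ a → sumF-cong (λ b →
           trans (count-∧ˡ (x a) (λ c → y b ∧ z c)) (cong (𝟙 (x a) *_) (count-∧ˡ (y b) z)))) ⟩
    sumF² (λ a b → 𝟙 (x a) * (𝟙 (y b) * count z))
      ≡⟨ sumF-cong (λ a →
           trans (sumF-*ˡ (𝟙 (x a)) (λ b → 𝟙 (y b) * count z)) (cong (𝟙 (x a) *_) (sumF-𝟙-* y (count z)))) ⟩
    sumF (λ a → 𝟙 (x a) * (count y * count z))
      ≡⟨ sumF-𝟙-* x (count y * count z) ⟩
    count x * (count y * count z) ∎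
    where open ≡-Reasoning

  disjoint-boxes≤f123 :
    (x₁ y₁ : Fin (n1 K) → Bool) (x₂ y₂ : Fin (n2 K) → Bool) (x₃ y₃ : Fin (n3 K) → Bool) →
    (∀ a b c → T (x₁ a ∧ (x₂ b ∧ x₃ c)) → T (t K a b c)) →
    (∀ a b c → T (y₁ a ∧ (y₂ b ∧ y₃ c)) → T (t K a b c)) →
    (∀ a b c → T (x₁ a ∧ (x₂ b ∧ x₃ c)) → T (y₁ a ∧ (y₂ b ∧ y₃ c)) → ⊥) →
    count x₁ * (count x₂ * count x₃) + count y₁ * (count y₂ * count y₃) ≤ f123 K
  disjoint-boxes≤f123 x₁ y₁ x₂ y₂ x₃ y₃ x⊆t y⊆t x∩y = begin
    count x₁ * (count x₂ * count x₃) + count y₁ * (count y₂ * count y₃)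
      ≡⟨ sym (cong₂ _+_ (count-box x₁ x₂ x₃) (count-box y₁ y₂ y₃)) ⟩
    sumF² (λ a b → count (X a b)) + sumF² (λ a b → count (Y a b))
      ≡⟨ sym (sumF²-+ (λ a b → count (X a b)) (λ a b → count (Y a b))) ⟩
    sumF² (λ a b → count (X a b) + count (Y a b))
      ≤⟨ sumF²-mono (λ a b → count-disjoint (x⊆t a b) (y⊆t a b) (x∩y a b)) ⟩
    f123 K ∎
    where
    open ≤-Reasoning
    X Y : Fin (n1 K) → Fin (n2 K) → Fin (n3 K) → Bool
    X a b c = x₁ a ∧ (x₂ b ∧ x₃ c)
    Y a b c = y₁ a ∧ (y₂ b ∧ y₃ c)

*≤⇒≤fdiv : ∀ {m n d} → 1 ≤ n → n * d ≤ m → d ≤ fdiv m n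
*≤⇒≤fdiv {m} {suc n} {d} _ nd≤m =
  subst (_≤ m / suc n) (m*n/n≡m d (suc n)) (/-monoˡ-≤ (suc n) (subst (_≤ m) (*-comm (suc n) d) nd≤m))

*fdiv≤ : ∀ m n → n * fdiv m n ≤ m
*fdiv≤ m zero    = z≤n
*fdiv≤ m (suc n) = subst (_≤ m) (*-comm (m / suc n) (suc n)) (m/n*n≤m m (suc n))

fdiv≤ : ∀ {m n k} → 1 ≤ n → m ≤ n * k → fdiv m n ≤ k
fdiv≤ {m} {suc n} _ m≤nk = *-cancelˡ-≤ (suc n) (≤-trans (*fdiv≤ m (suc n)) m≤nk)

f123≡F*E⇔ : ∀ K {F E A B} → 1 ≤ F → 1 ≤ E → f1 K ≤ F → f23 K ≤ E → f12 K ≤ A → f13 K ≤ B →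
            (E ≤ fdiv A F * fdiv B F → F * E ≤ f123 K) →
            (f123 K ≡ F * E) ⇔ (E ≤ fdiv A F * fdiv B F)
f123≡F*E⇔ K {F} {E} {A} {B} F>0 E>0 f1≤F f23≤E f12≤A f13≤B lower = mk⇔ tight⇒bound bound⇒tight
  where
  upper : f123 K ≤ F * E
  upper = ≤-trans (f123≤f1*f23 K) (*-mono-≤ f1≤F f23≤E)

  bound⇒tight : E ≤ fdiv A F * fdiv B F → f123 K ≡ F * E
  bound⇒tight bound = ≤-antisym upper (lower bound)

  tight⇒bound : f123 K ≡ F * E → E ≤ fdiv A F * fdiv B F
  tight⇒bound f123≡ =
    let (d₁₂ , d₁₃ , f1*d₁₂≤f12 , f1*d₁₃≤f13 , f23≤d₁₂*d₁₃) =
          f1*f23≤f123⇒degrees K (≤-trans F>0 F≤f1) f1*f23≤f123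
    in begin
      E                          ≤⟨ E≤f23 ⟩
      f23 K                      ≤⟨ f23≤d₁₂*d₁₃ ⟩
      d₁₂ * d₁₃                  ≤⟨ *-mono-≤ (degree≤fdiv f1*d₁₂≤f12 f12≤A) (degree≤fdiv f1*d₁₃≤f13 f13≤B) ⟩
      fdiv A F * fdiv B F        ∎
    where
    open ≤-Reasoning
    F*E≤f1*f23 : F * E ≤ f1 K * f23 K
    F*E≤f1*f23 = subst (_≤ f1 K * f23 K) f123≡ (f123≤f1*f23 K)
    F≤f1 : F ≤ f1 K
    F≤f1 = *-cancelʳ-≤ F (f1 K) E {{>-nonZero E>0}} (≤-trans F*E≤f1*f23 (*-monoʳ-≤ (f1 K) f23≤E))
    E≤f23 : E ≤ f23 K
    E≤f23 = *-cancelˡ-≤ F {{>-nonZero F>0}} (≤-trans F*E≤f1*f23 (*-monoˡ-≤ (f23 K) f1≤F))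
    f1*f23≤f123 : f1 K * f23 K ≤ f123 K
    f1*f23≤f123 = ≤-trans (*-mono-≤ f1≤F f23≤E) (≤-reflexive (sym f123≡))
    degree≤fdiv : ∀ {d fK fΔ} → f1 K * d ≤ fK → fK ≤ fΔ → d ≤ fdiv fΔ F
    degree≤fdiv {d} f1*d≤ ≤fΔ = *≤⇒≤fdiv F>0 (≤-trans (*-monoˡ-≤ d F≤f1) (≤-trans f1*d≤ ≤fΔ))

record RowSplit (E A B : ℕ) : Set where
  field
    width rows rest : ℕ
    1≤width       : 1 ≤ width
    width≤A       : width ≤ A
    1≤rows        : 1 ≤ rows
    rows≤B        : rows ≤ B
    E≡            : E ≡ rows * width + rest
    rest<width    : rest < width
    rest>0⇒rows<B : 1 ≤ rest → rows < B

m*n>0⇒m>0×n>0 : ∀ m n → 1 ≤ m * n → 1 ≤ m × 1 ≤ n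
m*n>0⇒m>0×n>0 (suc m) (suc n) _ = s≤s z≤n , s≤s z≤n
m*n>0⇒m>0×n>0 (suc m) zero    mn>0 = ⊥-elim (<⇒≱ mn>0 (≤-reflexive (*-zeroʳ m)))

rowSplit : ∀ {E A B} → 1 ≤ E → E ≤ A * B → RowSplit E A B
rowSplit {E} {A} {B} E>0 E≤A*B with m*n>0⇒m>0×n>0 A B (≤-trans E>0 E≤A*B) | ≤-total A E
... | _ , B>0 | inj₂ E≤A = record
  { width = E ; rows = 1 ; rest = 0
  ; 1≤width = E>0 ; width≤A = E≤A ; 1≤rows = ≤-refl ; rows≤B = B>0
  ; E≡ = sym (trans (+-identityʳ _) (*-identityˡ E)) ; rest<width = E>0 ; rest>0⇒rows<B = λ () }
... | A>0 , _ | inj₁ A≤E = record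
  { width = A ; rows = E / A ; rest = E % A
  ; 1≤width = A>0 ; width≤A = ≤-refl ; 1≤rows = rows>0 ; rows≤B = rows≤B
  ; E≡ = trans E≡rest+rows*A (+-comm (E % A) _) ; rest<width = m%n<n E A ; rest>0⇒rows<B = rows<B }
  where
  instance
    A≢0 : NonZero A
    A≢0 = >-nonZero A>0
  E≡rest+rows*A : E ≡ E % A + (E / A) * A
  E≡rest+rows*A = m≡m%n+[m/n]*n E A
  rest+rows*A≤B*A : E % A + (E / A) * A ≤ B * A
  rest+rows*A≤B*A = ≤-trans (≤-reflexive (sym E≡rest+rows*A)) (subst (E ≤_) (*-comm A B) E≤A*B)
  rows>0 : 1 ≤ E / A
  rows>0 = m≥n⇒m/n>0 A≤E
  rows≤B : E / A ≤ B
  rows≤B = *-cancelʳ-≤ (E / A) B A (≤-trans (m≤n+m _ (E % A)) rest+rows*A≤B*A)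
  rows<B : 1 ≤ E % A → E / A < B
  rows<B rest>0 = *-cancelʳ-< A (E / A) B (≤-trans (+-monoˡ-≤ ((E / A) * A) rest>0) rest+rows*A≤B*A)

m+[k⊓[n∸m]]≤n : ∀ {m n} k → m ≤ n → m + k ⊓ (n ∸ m) ≤ n
m+[k⊓[n∸m]]≤n {m} {n} k m≤n = ≤-trans (+-monoʳ-≤ m (m⊓n≤n k (n ∸ m))) (≤-reflexive (m+[n∸m]≡n m≤n))

m⊓[n∸k]≡m : ∀ {m n} k → k + m ≤ n → m ⊓ (n ∸ k) ≡ m
m⊓[n∸k]≡m {m} {n} k k+m≤n = m≤n⇒m⊓n≡m (subst (_≤ n ∸ k) (m+n∸m≡n k m) (∸-monoˡ-≤ k k+m≤n))

m⊓[n∸k]≡r : ∀ {m n k r} → n ≡ k + r → r ≤ m → m ⊓ (n ∸ k) ≡ r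
m⊓[n∸k]≡r {m} {k = k} {r} refl r≤m = trans (cong (m ⊓_) (m+n∸m≡n k r)) (m≥n⇒m⊓n≡n r≤m)

F*[hw+r]≤ : ∀ F {E h w r X Y} → E ≡ h * w + r → F * (h * w) ≤ X → (1 ≤ r → F * r ≤ Y) → F * E ≤ X + Y
F*[hw+r]≤ F {h = h} {w} {zero}  refl F*hw≤X _ =
  ≤-trans (≤-reflexive (cong (F *_) (+-identityʳ (h * w)))) (≤-trans F*hw≤X (m≤m+n _ _))
F*[hw+r]≤ F {h = h} {w} {suc r} refl F*hw≤X F*r≤Y =
  ≤-trans (≤-reflexive (*-distribˡ-+ F (h * w) (suc r))) (+-mono-≤ F*hw≤X (F*r≤Y (s≤s z≤n)))

m≤m*n⁺ : ∀ m {n} → 1 ≤ n → m ≤ m * n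
m≤m*n⁺ m {suc n} _ = m≤m*n m (suc n)

h*F+F≤ : ∀ {h X} F → h < fdiv X F → h * F + F ≤ X
h*F+F≤ {h} {X} F h<X/F =
  subst (_≤ X) (+-comm F (h * F)) (≤-trans (*-monoˡ-≤ F h<X/F) (subst (_≤ X) (*-comm F _) (*fdiv≤ X F)))

==⇒≡ : ∀ {i j} → T (i == j) → i ≡ j
==⇒≡ {zero}           {zero}           _ = refl
==⇒≡ {suc zero}       {suc zero}       _ = refl
==⇒≡ {suc (suc zero)} {suc (suc zero)} _ = refl

==-refl : ∀ i → (i == i) ≡ true
==-refl zero             = refl
==-refl (suc zero)       = refl
==-refl (suc (suc zero)) = refl

fE-sym : ∀ Δ i j → fE Δ i j ≡ fE Δ j i
fE-sym Δ zero             zero             = refl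
fE-sym Δ zero             (suc zero)       = refl
fE-sym Δ zero             (suc (suc zero)) = refl
fE-sym Δ (suc zero)       zero             = refl
fE-sym Δ (suc zero)       (suc zero)       = refl
fE-sym Δ (suc zero)       (suc (suc zero)) = refl
fE-sym Δ (suc (suc zero)) zero             = refl
fE-sym Δ (suc (suc zero)) (suc zero)       = refl
fE-sym Δ (suc (suc zero)) (suc (suc zero)) = refl

module Bounds (Δ : Complex3) (π : Params) where
  open Construction Δ π hiding (Γ; InA; edgeSum)

  Q≡false : g π (q π) ≡ fV Δ (q π) → Q ≡ false
  Q≡false gq≡ = trans (cong (_<ᵇ fV Δ (q π)) gq≡) (n<ᵇn (fV Δ (q π)))
    where
    n<ᵇn : ∀ n → (n <ᵇ n) ≡ false
    n<ᵇn zero    = refl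
    n<ᵇn (suc n) = n<ᵇn n

  vertices≤ : Q ≡ false → ∀ i → g π i ≤ fV Δ i → nΓ i ≤ fV Δ i
  vertices≤ Q≡f i gi≤ = begin
    g π i + 𝟙 ((i == p π) ∧ P) + 𝟙 ((i == q π) ∧ Q)
      ≡⟨ cong (λ b → g π i + 𝟙 ((i == p π) ∧ P) + 𝟙 b) (trans (cong ((i == q π) ∧_) Q≡f) (∧-zeroʳ _)) ⟩
    g π i + 𝟙 ((i == p π) ∧ P) + 0
      ≡⟨ +-identityʳ _ ⟩
    g π i + 𝟙 ((i == p π) ∧ P)
      ≤⟨ new-p _ (λ h → let (i≡p , tP) = to T-∧ h in
                         subst (λ c → g π c < fV Δ c) (sym (==⇒≡ i≡p)) (<ᵇ⇒< _ _ tP)) ⟩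
    fV Δ i ∎
    where
    open ≤-Reasoning
    new-p : ∀ b → (T b → g π i < fV Δ i) → g π i + 𝟙 b ≤ fV Δ i
    new-p true  gi< = subst (_≤ fV Δ i) (+-comm 1 (g π i)) (gi< _)
    new-p false _   = ≤-trans (≤-reflexive (+-identityʳ _)) gi≤

  GridFits : Set
  GridFits = g π c1 * g π c2 ≤ f12 Δ × g π c1 * g π c3 ≤ f13 Δ × g π c2 * g π c3 ≤ f23 Δ

  gridFits : GridFits → ∀ i j → i ≢ j → g π i * g π j ≤ fE Δ i j
  gridFits (g12 , g13 , g23) = λ where
    zero             zero             i≢j → ⊥-elim (i≢j refl)
    zero             (suc zero)       _   → g12
    zero             (suc (suc zero)) _   → g13
    (suc zero)       zero             _   → subst (_≤ f12 Δ) (*-comm (g π c1) _) g12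
    (suc zero)       (suc zero)       i≢j → ⊥-elim (i≢j refl)
    (suc zero)       (suc (suc zero)) _   → g23
    (suc (suc zero)) zero             _   → subst (_≤ f13 Δ) (*-comm (g π c1) _) g13
    (suc (suc zero)) (suc zero)       _   → subst (_≤ f23 Δ) (*-comm (g π c2) _) g23
    (suc (suc zero)) (suc (suc zero)) i≢j → ⊥-elim (i≢j refl)

  edgeCount : Fin 3 → Fin 3 → ℕ
  edgeCount i j = sumF {nΓ i} (λ a → count {nΓ j} (λ b → adj i j (toℕ a) (toℕ b)))

  𝟙-pEdge : ∀ i j a b → 𝟙 (pEdge i j a b) ≤ 𝟙 (i == p π) * (𝟙 (a ≡ᵇ g π (p π)) * 𝟙 (b <ᵇ kP j))
  𝟙-pEdge i j a b = begin
    𝟙 (P ∧ ((i == p π) ∧ ((a ≡ᵇ g π (p π)) ∧ (b <ᵇ kP j))))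
      ≤⟨ 𝟙-mono (λ h → proj₂ (to (T-∧ {P}) h)) ⟩
    𝟙 ((i == p π) ∧ ((a ≡ᵇ g π (p π)) ∧ (b <ᵇ kP j)))
      ≡⟨ trans (𝟙-∧ (i == p π) _) (cong (𝟙 (i == p π) *_) (𝟙-∧ (a ≡ᵇ g π (p π)) (b <ᵇ kP j))) ⟩
    𝟙 (i == p π) * (𝟙 (a ≡ᵇ g π (p π)) * 𝟙 (b <ᵇ kP j)) ∎
    where open ≤-Reasoning

  𝟙-adj≤ : Q ≡ false → ∀ i j a b → 𝟙 (adj i j a b) ≤
           𝟙 (a <ᵇ g π i) * 𝟙 (b <ᵇ g π j)
           + (𝟙 (i == p π) * (𝟙 (a ≡ᵇ g π (p π)) * 𝟙 (b <ᵇ kP j))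
              + 𝟙 (j == p π) * (𝟙 (a <ᵇ kP i) * 𝟙 (b ≡ᵇ g π (p π))))
  𝟙-adj≤ Q≡f i j a b = begin
    𝟙 (base i j a b ∨ (pEdge i j a b ∨ (pEdge j i b a ∨ (qEdge i j a b ∨ qEdge j i b a))))
      ≤⟨ ≤-trans (𝟙-∨ (base i j a b) _) (+-monoʳ-≤ _ (≤-trans (𝟙-∨ (pEdge i j a b) _)
           (+-monoʳ-≤ _ (≤-trans (𝟙-∨ (pEdge j i b a) _) (+-monoʳ-≤ _ no-qEdge))))) ⟩
    𝟙 (base i j a b) + (𝟙 (pEdge i j a b) + (𝟙 (pEdge j i b a) + 0))
      ≤⟨ +-mono-≤ (≤-reflexive (𝟙-∧ (a <ᵇ g π i) (b <ᵇ g π j)))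
           (+-mono-≤ (𝟙-pEdge i j a b) (≤-trans (≤-reflexive (+-identityʳ _)) pEdge-ji)) ⟩
    _ ∎
    where
    open ≤-Reasoning
    no-qEdge : 𝟙 (qEdge i j a b ∨ qEdge j i b a) ≤ 0
    no-qEdge = ≤-trans (𝟙-∨ (qEdge i j a b) _) (≤-reflexive (cong₂ _+_
      (cong (λ z → 𝟙 (z ∧ ((i == q π) ∧ ((a ≡ᵇ g π (q π)) ∧ (b <ᵇ kQ j))))) Q≡f)
      (cong (λ z → 𝟙 (z ∧ ((j == q π) ∧ ((b ≡ᵇ g π (q π)) ∧ (a <ᵇ kQ i))))) Q≡f)))
    pEdge-ji : 𝟙 (pEdge j i b a) ≤ 𝟙 (j == p π) * (𝟙 (a <ᵇ kP i) * 𝟙 (b ≡ᵇ g π (p π)))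
    pEdge-ji = ≤-trans (𝟙-pEdge j i b a) (≤-reflexive (cong (𝟙 (j == p π) *_) (*-comm (𝟙 (b ≡ᵇ g π (p π))) _)))

  edges≤ : Q ≡ false → ∀ i j → edgeCount i j ≤ g π i * g π j + (𝟙 (i == p π) * kP j + 𝟙 (j == p π) * kP i)
  edges≤ Q≡f i j = begin
    edgeCount i j
      ≡⟨ sumF-cong {nΓ i} (λ a → count≡sumF {nΓ j} (λ b → adj i j (toℕ a) (toℕ b))) ⟩
    sumF² 𝟙-adjᵢⱼ
      ≤⟨ sumF²-mono {nΓ i} {nΓ j} (λ a b → 𝟙-adj≤ Q≡f i j (toℕ a) (toℕ b)) ⟩
    sumF² (λ a b → grid a b + (𝟙 (i == p π) * rectᵢ a b + 𝟙 (j == p π) * rectⱼ a b))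
      ≡⟨ trans (sumF²-+ grid _) (cong (sumF² grid +_)
           (trans (sumF²-+ (λ a b → 𝟙 (i == p π) * rectᵢ a b) (λ a b → 𝟙 (j == p π) * rectⱼ a b))
           (cong₂ _+_ (sumF²-*ˡ (𝟙 (i == p π)) rectᵢ) (sumF²-*ˡ (𝟙 (j == p π)) rectⱼ)))) ⟩
    sumF² grid + (𝟙 (i == p π) * sumF² rectᵢ + 𝟙 (j == p π) * sumF² rectⱼ)
      ≤⟨ +-mono-≤ (sumF²-𝟙-rect≤ (belowᵢ (g π i)) (belowⱼ (g π j)) (belowᵢ≤ (g π i)) (belowⱼ≤ (g π j)))
           (+-mono-≤
             (*-monoʳ-≤ (𝟙 (i == p π)) (sumF²-𝟙-rect≤ at-pᵢ (belowⱼ (kP j)) (count-≡ᵇ≤1 (nΓ i) _) (belowⱼ≤ (kP j))))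
             (*-monoʳ-≤ (𝟙 (j == p π)) (sumF²-𝟙-rect≤ (belowᵢ (kP i)) at-pⱼ (belowᵢ≤ (kP i)) (count-≡ᵇ≤1 (nΓ j) _)))) ⟩
    g π i * g π j + (𝟙 (i == p π) * (1 * kP j) + 𝟙 (j == p π) * (kP i * 1))
      ≡⟨ cong (λ x → g π i * g π j + x)
           (cong₂ (λ x y → 𝟙 (i == p π) * x + 𝟙 (j == p π) * y) (*-identityˡ _) (*-identityʳ _)) ⟩
    g π i * g π j + (𝟙 (i == p π) * kP j + 𝟙 (j == p π) * kP i) ∎
    where
    open ≤-Reasoning
    belowᵢ : ℕ → Fin (nΓ i) → Bool
    belowᵢ k a = toℕ a <ᵇ k
    belowⱼ : ℕ → Fin (nΓ j) → Bool
    belowⱼ k b = toℕ b <ᵇ k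
    at-pᵢ : Fin (nΓ i) → Bool
    at-pᵢ a = toℕ a ≡ᵇ g π (p π)
    at-pⱼ : Fin (nΓ j) → Bool
    at-pⱼ b = toℕ b ≡ᵇ g π (p π)
    belowᵢ≤ : ∀ k → count (belowᵢ k) ≤ k
    belowᵢ≤ k = ≤-trans (≤-reflexive (count-<ᵇ (nΓ i) k)) (m⊓n≤n (nΓ i) k)
    belowⱼ≤ : ∀ k → count (belowⱼ k) ≤ k
    belowⱼ≤ k = ≤-trans (≤-reflexive (count-<ᵇ (nΓ j) k)) (m⊓n≤n (nΓ j) k)
    𝟙-adjᵢⱼ grid rectᵢ rectⱼ : Fin (nΓ i) → Fin (nΓ j) → ℕ
    𝟙-adjᵢⱼ a b = 𝟙 (adj i j (toℕ a) (toℕ b))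
    grid    a b = 𝟙 (belowᵢ (g π i) a) * 𝟙 (belowⱼ (g π j) b)
    rectᵢ   a b = 𝟙 (at-pᵢ a) * 𝟙 (belowⱼ (kP j) b)
    rectⱼ   a b = 𝟙 (belowᵢ (kP i) a) * 𝟙 (at-pⱼ b)

  kP-fits : ∀ i j → i ≡ p π → g π i * g π j ≤ fE Δ i j → g π i * g π j + kP j ≤ fE Δ i j
  kP-fits _ j refl = m+[k⊓[n∸m]]≤n (g π j)

  edges≤fE : Q ≡ false → GridFits → ∀ i j → i ≢ j → edgeCount i j ≤ fE Δ i j
  edges≤fE Q≡f fits i j i≢j = ≤-trans (edges≤ Q≡f i j) (new-edges≤ (i == p π) (j == p π) refl refl)
    where
    new-edges≤ : ∀ bi bj → bi ≡ (i == p π) → bj ≡ (j == p π) →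
                 g π i * g π j + (𝟙 bi * kP j + 𝟙 bj * kP i) ≤ fE Δ i j
    new-edges≤ true  true  i=p j=p = ⊥-elim (i≢j (trans (==⇒≡ (subst T i=p _)) (sym (==⇒≡ (subst T j=p _)))))
    new-edges≤ true  false i=p _   = begin
      g π i * g π j + (kP j + 0 + 0)  ≡⟨ cong (g π i * g π j +_) (trans (+-identityʳ _) (+-identityʳ _)) ⟩
      g π i * g π j + kP j            ≤⟨ kP-fits i j (==⇒≡ (subst T i=p _)) (gridFits fits i j i≢j) ⟩
      fE Δ i j                        ∎
      where open ≤-Reasoning
    new-edges≤ false true  _   j=p = begin
      g π i * g π j + (kP i + 0)      ≡⟨ cong₂ _+_ (*-comm (g π i) (g π j)) (+-identityʳ _) ⟩
      g π j * g π i + kP i            ≤⟨ kP-fits j i (==⇒≡ (subst T j=p _)) (gridFits fits j i (≢-sym i≢j)) ⟩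
      fE Δ j i                        ≡⟨ fE-sym Δ j i ⟩
      fE Δ i j                        ∎
      where open ≤-Reasoning
    new-edges≤ false false _   _   = ≤-trans (≤-reflexive (+-identityʳ _)) (gridFits fits i j i≢j)

  inA : (∀ i → 1 ≤ g π i) → p π ≢ q π → g π (q π) ≡ fV Δ (q π) → (∀ i → g π i ≤ fV Δ i) → GridFits →
        InA Δ π
  inA g>0 p≢q gq≡fq g≤fV fits =
    g>0 , p≢q , wellDefined ,
    vertices≤ Q≡f c1 (g≤fV c1) , vertices≤ Q≡f c2 (g≤fV c2) , vertices≤ Q≡f c3 (g≤fV c3) ,
    edges≤fE Q≡f fits c1 c2 (λ ()) , edges≤fE Q≡f fits c1 c3 (λ ()) , edges≤fE Q≡f fits c2 c3 (λ ())
    where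
    Q≡f : Q ≡ false
    Q≡f = Q≡false gq≡fq
    wellDefined : WellDefined
    wellDefined = (λ _ c c≢p → gridFits fits (p π) c (≢-sym c≢p)) ,
                  (λ tQ → ⊥-elim (subst T Q≡f tQ))

  g≤nΓ : ∀ i → g π i ≤ nΓ i
  g≤nΓ i = ≤-trans (m≤m+n (g π i) _) (m≤m+n _ _)

  kP≤g : ∀ i → kP i ≤ g π i
  kP≤g i = m⊓n≤m (g π i) _

  extraBoxᵇ : Bool → Fin 3 → ℕ → Bool
  extraBoxᵇ true  i x = P ∧ (x ≡ᵇ g π (p π))
  extraBoxᵇ false i x = x <ᵇ kP i

  -- The facets through the new vertex v^p_{g_p+1}: at color p it is the only
  -- choice, at the other colors its first kP neighbours.
  extraBox : Fin 3 → ℕ → Bool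
  extraBox i = extraBoxᵇ (i == p π) i

  extraCount : Fin 3 → ℕ
  extraCount i = count {nΓ i} (λ x → extraBox i (toℕ x))

  ∧-intro : ∀ x {y} → T x → T y → T (x ∧ y)
  ∧-intro x tx ty = from T-∧ (tx , ty)

  adj-base : ∀ i j a b → T (a <ᵇ g π i) → T (b <ᵇ g π j) → T (adj i j a b)
  adj-base i j a b ha hb = from T-∨ (inj₁ (from T-∧ (ha , hb)))

  adj-pEdge : ∀ i j a b → T (pEdge i j a b) → T (adj i j a b)
  adj-pEdge i j a b h = from (T-∨ {base i j a b}) (inj₂ (from (T-∨ {pEdge i j a b}) (inj₁ h)))

  adj-pEdge′ : ∀ i j a b → T (pEdge j i b a) → T (adj i j a b)
  adj-pEdge′ i j a b h =
    from (T-∨ {base i j a b}) (inj₂ (from (T-∨ {pEdge i j a b}) (inj₂ (from (T-∨ {pEdge j i b a}) (inj₁ h)))))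

  extraBox-adj : ∀ i j → i ≢ j → ∀ a b → T (extraBox i a) → T (extraBox j b) → T (adj i j a b)
  extraBox-adj i j i≢j a b = adjᵇ (i == p π) (j == p π) refl refl
    where
    adjᵇ : ∀ bi bj → bi ≡ (i == p π) → bj ≡ (j == p π) →
           T (extraBoxᵇ bi i a) → T (extraBoxᵇ bj j b) → T (adj i j a b)
    adjᵇ true  true  i=p j=p _ _ = ⊥-elim (i≢j (trans (==⇒≡ (subst T i=p _)) (sym (==⇒≡ (subst T j=p _)))))
    adjᵇ true  false i=p _   ha hb = let (tP , a≡) = to T-∧ ha in
      adj-pEdge i j a b (∧-intro P tP (∧-intro (i == p π) (subst T i=p _) (∧-intro (a ≡ᵇ g π (p π)) a≡ hb)))
    adjᵇ false true  _   j=p ha hb = let (tP , b≡) = to T-∧ hb in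
      adj-pEdge′ i j a b (∧-intro P tP (∧-intro (j == p π) (subst T j=p _) (∧-intro (b ≡ᵇ g π (p π)) b≡ ha)))
    adjᵇ false false _   _   ha hb = adj-base i j a b (below-mono ha (kP≤g i)) (below-mono hb (kP≤g j))
      where
      below-mono : ∀ {x k m} → T (x <ᵇ k) → k ≤ m → T (x <ᵇ m)
      below-mono {x} {k} x<k k≤m = <⇒<ᵇ (<-≤-trans (<ᵇ⇒< x k x<k) k≤m)

  triangle : (box : Fin 3 → ℕ → Bool) →
             (∀ i j → i ≢ j → ∀ a b → T (box i a) → T (box j b) → T (adj i j a b)) →
             ∀ a b c → T (box c1 a ∧ (box c2 b ∧ box c3 c)) →
             T (adj c1 c2 a b ∧ (adj c1 c3 a c ∧ adj c2 c3 b c))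
  triangle box box-adj a b c abc =
    let (ha , bc) = to T-∧ abc ; (hb , hc) = to T-∧ bc in
    from T-∧ (box-adj c1 c2 (λ ()) a b ha hb ,
      from T-∧ (box-adj c1 c3 (λ ()) a c ha hc , box-adj c2 c3 (λ ()) b c hb hc))

  base∩extraBox : ∀ i x → T (i == p π) → T (x <ᵇ g π i) → T (extraBox i x) → ⊥
  base∩extraBox i x i=p x<g extra =
    let (_ , x≡) = to T-∧ (subst (λ b → T (extraBoxᵇ b i x)) (to T-≡ i=p) extra) in
    <-irrefl (≡ᵇ⇒≡ x _ x≡) (subst (λ c → x < g π c) (==⇒≡ i=p) (<ᵇ⇒< x _ x<g))

  p-cases : T (c1 == p π) ⊎ T (c2 == p π) ⊎ T (c3 == p π)
  p-cases with p π
  ... | zero           = inj₁ _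
  ... | suc zero       = inj₂ (inj₁ _)
  ... | suc (suc zero) = inj₂ (inj₂ _)

  facets≥ : g π c1 * (g π c2 * g π c3) + extraCount c1 * (extraCount c2 * extraCount c3) ≤ f123 (Γ Δ π)
  facets≥ =
    subst (λ x → x + extraCount c1 * (extraCount c2 * extraCount c3) ≤ f123 (Γ Δ π))
      (cong₂ _*_ (count-base c1) (cong₂ _*_ (count-base c2) (count-base c3)))
      (disjoint-boxes≤f123 (Γ Δ π) (gridBox c1) (extra c1) (gridBox c2) (extra c2) (gridBox c3) (extra c3)
        (λ a b c → triangle (λ i x → x <ᵇ g π i) (λ i j _ → adj-base i j) (toℕ a) (toℕ b) (toℕ c))
        (λ a b c → triangle extraBox extraBox-adj (toℕ a) (toℕ b) (toℕ c))
        disjoint)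
    where
    gridBox extra : ∀ i → Fin (nΓ i) → Bool
    gridBox i x = toℕ x <ᵇ g π i
    extra i x = extraBox i (toℕ x)
    count-base : ∀ i → count (gridBox i) ≡ g π i
    count-base i = trans (count-<ᵇ (nΓ i) (g π i)) (m≥n⇒m⊓n≡n (g≤nΓ i))
    disjoint : ∀ a b c → T (gridBox c1 a ∧ (gridBox c2 b ∧ gridBox c3 c)) →
               T (extra c1 a ∧ (extra c2 b ∧ extra c3 c)) → ⊥
    disjoint a b c x y with to T-∧ x | to T-∧ y
    ... | xa , xbc | ya , ybc with to T-∧ xbc | to T-∧ ybc | p-cases
    ...   | xb , xc | yb , yc | inj₁ p₁        = base∩extraBox c1 (toℕ a) p₁ xa ya
    ...   | xb , xc | yb , yc | inj₂ (inj₁ p₂) = base∩extraBox c2 (toℕ b) p₂ xb yb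
    ...   | xb , xc | yb , yc | inj₂ (inj₂ p₃) = base∩extraBox c3 (toℕ c) p₃ xc yc

  extraCount-p : T P → 1 ≤ extraCount (p π)
  extraCount-p tP =
    subst (λ b → 1 ≤ count {nΓ (p π)} (λ x → extraBoxᵇ b (p π) (toℕ x))) (sym (==-refl (p π)))
      (subst (1 ≤_) (sym (count-∧-T {nΓ (p π)} tP)) (count-≡ᵇ≥1 (nΓ (p π)) (g π (p π)) g<nΓ))
    where
    new-p : 𝟙 ((p π == p π) ∧ P) ≡ 1
    new-p = cong 𝟙 (trans (cong (_∧ P) (==-refl (p π))) (to T-≡ tP))
    g<nΓ : g π (p π) < nΓ (p π)
    g<nΓ = <-≤-trans (m<m+n (g π (p π)) (subst (0 <_) (sym new-p) (s≤s z≤n))) (m≤m+n _ _)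

  extraCount-other : ∀ i → (i == p π) ≡ false → extraCount i ≡ kP i
  extraCount-other i i≠p =
    subst (λ b → count {nΓ i} (λ x → extraBoxᵇ b i (toℕ x)) ≡ kP i) (sym i≠p)
      (trans (count-<ᵇ (nΓ i) (kP i)) (m≥n⇒m⊓n≡n (≤-trans (kP≤g i) (g≤nΓ i))))

Achievable : Complex3 → ℕ → Set
Achievable Δ N = Σ Params (λ π → InA Δ π × N ≤ f123 (Γ Δ π))

achievable₁ : ∀ Δ → AllPositive Δ → f23 Δ ≤ fdiv (f12 Δ) (f1 Δ) * fdiv (f13 Δ) (f1 Δ) →
              Achievable Δ (f1 Δ * f23 Δ)
achievable₁ Δ (f1>0 , _ , _ , _ , _ , f23>0 , _) bound = π , π∈A , lower
  where
  open RowSplit (rowSplit {A = fdiv (f12 Δ) (f1 Δ)} {B = fdiv (f13 Δ) (f1 Δ)} f23>0 bound)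
  F : ℕ
  F = f1 Δ
  gs : Fin 3 → ℕ
  gs zero             = F
  gs (suc zero)       = width
  gs (suc (suc zero)) = rows
  π : Params
  π = params gs c3 c1
  open Bounds Δ π
  open Construction Δ π using (P; kP)

  π∈A : InA Δ π
  π∈A = inA (λ { zero → f1>0 ; (suc zero) → 1≤width ; (suc (suc zero)) → 1≤rows }) (λ ()) refl
    (λ { zero → ≤-refl
       ; (suc zero) → ≤-trans width≤A (fdiv≤ f1>0 (f12≤f1*f2 Δ))
       ; (suc (suc zero)) → ≤-trans rows≤B (fdiv≤ f1>0 (f13≤f1*f3 Δ)) })
    ( ≤-trans (*-monoʳ-≤ F width≤A) (*fdiv≤ (f12 Δ) F)
    , ≤-trans (*-monoʳ-≤ F rows≤B) (*fdiv≤ (f13 Δ) F)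
    , ≤-trans (≤-reflexive (*-comm width rows)) (≤-trans (m≤m+n _ rest) (≤-reflexive (sym E≡))))

  extra≥ : 1 ≤ rest → F * rest ≤ extraCount c1 * (extraCount c2 * extraCount c3)
  extra≥ rest>0 = begin
    F * rest                    ≤⟨ *-monoʳ-≤ F (m≤m*n⁺ rest (extraCount-p tP)) ⟩
    F * (rest * extraCount c3)  ≡⟨ sym (cong₂ (λ x y → x * (y * extraCount c3))
                                      (trans (extraCount-other c1 refl) kP₁≡F) (trans (extraCount-other c2 refl) kP₂≡rest)) ⟩
    extraCount c1 * (extraCount c2 * extraCount c3) ∎
    where
    open ≤-Reasoning
    tP : T P
    tP = <⇒<ᵇ (<-≤-trans (rest>0⇒rows<B rest>0) (fdiv≤ f1>0 (f13≤f1*f3 Δ)))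
    kP₁≡F : kP c1 ≡ F
    kP₁≡F = m⊓[n∸k]≡m (rows * F) (h*F+F≤ F (rest>0⇒rows<B rest>0))
    kP₂≡rest : kP c2 ≡ rest
    kP₂≡rest = m⊓[n∸k]≡r E≡ (<⇒≤ rest<width)

  lower : F * f23 Δ ≤ f123 (Γ Δ π)
  lower = ≤-trans (F*[hw+r]≤ F {h = rows} {w = width} E≡ (≤-reflexive (cong (F *_) (*-comm rows width))) extra≥)
                  facets≥

achievable₂ : ∀ Δ → AllPositive Δ → f13 Δ ≤ fdiv (f12 Δ) (f2 Δ) * fdiv (f23 Δ) (f2 Δ) →
              Achievable Δ (f2 Δ * f13 Δ)
achievable₂ Δ (_ , f2>0 , _ , _ , f13>0 , _ , _) bound = π , π∈A , lower
  where
  open RowSplit (rowSplit {A = fdiv (f12 Δ) (f2 Δ)} {B = fdiv (f23 Δ) (f2 Δ)} f13>0 bound)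
  F : ℕ
  F = f2 Δ
  gs : Fin 3 → ℕ
  gs zero             = width
  gs (suc zero)       = F
  gs (suc (suc zero)) = rows
  π : Params
  π = params gs c3 c2
  open Bounds Δ π
  open Construction Δ π using (P; kP)

  π∈A : InA Δ π
  π∈A = inA (λ { zero → 1≤width ; (suc zero) → f2>0 ; (suc (suc zero)) → 1≤rows }) (λ ()) refl
    (λ { zero → ≤-trans width≤A (fdiv≤ f2>0 (subst (f12 Δ ≤_) (*-comm (f1 Δ) F) (f12≤f1*f2 Δ)))
       ; (suc zero) → ≤-refl
       ; (suc (suc zero)) → ≤-trans rows≤B (fdiv≤ f2>0 (f23≤f2*f3 Δ)) })
    ( ≤-trans (≤-reflexive (*-comm width F)) (≤-trans (*-monoʳ-≤ F width≤A) (*fdiv≤ (f12 Δ) F))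
    , ≤-trans (≤-reflexive (*-comm width rows)) (≤-trans (m≤m+n _ rest) (≤-reflexive (sym E≡)))
    , ≤-trans (*-monoʳ-≤ F rows≤B) (*fdiv≤ (f23 Δ) F))

  extra≥ : 1 ≤ rest → F * rest ≤ extraCount c1 * (extraCount c2 * extraCount c3)
  extra≥ rest>0 = begin
    F * rest                    ≤⟨ *-monoʳ-≤ F (m≤m*n⁺ rest (extraCount-p tP)) ⟩
    F * (rest * extraCount c3)  ≡⟨ x∙yz≈y∙xz F rest (extraCount c3) ⟩
    rest * (F * extraCount c3)  ≡⟨ sym (cong₂ (λ x y → x * (y * extraCount c3))
                                      (trans (extraCount-other c1 refl) kP₁≡rest) (trans (extraCount-other c2 refl) kP₂≡F)) ⟩
    extraCount c1 * (extraCount c2 * extraCount c3) ∎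
    where
    open ≤-Reasoning
    tP : T P
    tP = <⇒<ᵇ (<-≤-trans (rest>0⇒rows<B rest>0) (fdiv≤ f2>0 (f23≤f2*f3 Δ)))
    kP₁≡rest : kP c1 ≡ rest
    kP₁≡rest = m⊓[n∸k]≡r E≡ (<⇒≤ rest<width)
    kP₂≡F : kP c2 ≡ F
    kP₂≡F = m⊓[n∸k]≡m (rows * F) (h*F+F≤ F (rest>0⇒rows<B rest>0))

  lower : F * f13 Δ ≤ f123 (Γ Δ π)
  lower = ≤-trans (F*[hw+r]≤ F {h = rows} {w = width} E≡ (≤-reflexive (x∙yz≈z∙xy F rows width)) extra≥)
                  facets≥

achievable₃ : ∀ Δ → AllPositive Δ → f12 Δ ≤ fdiv (f13 Δ) (f3 Δ) * fdiv (f23 Δ) (f3 Δ) →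
              Achievable Δ (f3 Δ * f12 Δ)
achievable₃ Δ (_ , _ , f3>0 , f12>0 , _ , _ , _) bound = π , π∈A , lower
  where
  open RowSplit (rowSplit {A = fdiv (f23 Δ) (f3 Δ)} {B = fdiv (f13 Δ) (f3 Δ)} f12>0
                          (≤-trans bound (≤-reflexive (*-comm (fdiv (f13 Δ) (f3 Δ)) _))))
  F : ℕ
  F = f3 Δ
  gs : Fin 3 → ℕ
  gs zero             = rows
  gs (suc zero)       = width
  gs (suc (suc zero)) = F
  π : Params
  π = params gs c1 c3
  open Bounds Δ π
  open Construction Δ π using (P; kP)

  π∈A : InA Δ π
  π∈A = inA (λ { zero → 1≤rows ; (suc zero) → 1≤width ; (suc (suc zero)) → f3>0 }) (λ ()) refl
    (λ { zero → ≤-trans rows≤B (fdiv≤ f3>0 (subst (f13 Δ ≤_) (*-comm (f1 Δ) F) (f13≤f1*f3 Δ)))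
       ; (suc zero) → ≤-trans width≤A (fdiv≤ f3>0 (subst (f23 Δ ≤_) (*-comm (f2 Δ) F) (f23≤f2*f3 Δ)))
       ; (suc (suc zero)) → ≤-refl })
    ( ≤-trans (m≤m+n _ rest) (≤-reflexive (sym E≡))
    , ≤-trans (≤-reflexive (*-comm rows F)) (≤-trans (*-monoʳ-≤ F rows≤B) (*fdiv≤ (f13 Δ) F))
    , ≤-trans (≤-reflexive (*-comm width F)) (≤-trans (*-monoʳ-≤ F width≤A) (*fdiv≤ (f23 Δ) F)))

  extra≥ : 1 ≤ rest → F * rest ≤ extraCount c1 * (extraCount c2 * extraCount c3)
  extra≥ rest>0 = begin
    F * rest                    ≡⟨ *-comm F rest ⟩
    rest * F                    ≤⟨ m≤m*n⁺ (rest * F) (extraCount-p tP) ⟩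
    rest * F * extraCount c1    ≡⟨ *-comm (rest * F) (extraCount c1) ⟩
    extraCount c1 * (rest * F)  ≡⟨ sym (cong₂ (λ x y → extraCount c1 * (x * y))
                                      (trans (extraCount-other c2 refl) kP₂≡rest) (trans (extraCount-other c3 refl) kP₃≡F)) ⟩
    extraCount c1 * (extraCount c2 * extraCount c3) ∎
    where
    open ≤-Reasoning
    tP : T P
    tP = <⇒<ᵇ (<-≤-trans (rest>0⇒rows<B rest>0) (fdiv≤ f3>0 (subst (f13 Δ ≤_) (*-comm (f1 Δ) F) (f13≤f1*f3 Δ))))
    kP₂≡rest : kP c2 ≡ rest
    kP₂≡rest = m⊓[n∸k]≡r E≡ (<⇒≤ rest<width)
    kP₃≡F : kP c3 ≡ F
    kP₃≡F = m⊓[n∸k]≡m (rows * F) (h*F+F≤ F (rest>0⇒rows<B rest>0))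

  lower : F * f12 Δ ≤ f123 (Γ Δ π)
  lower = ≤-trans (F*[hw+r]≤ F {h = rows} {w = width} E≡ (≤-reflexive (x∙yz≈y∙zx F rows width)) extra≥)
                  facets≥

lemma2p9 : (Δ : Complex3) → AllPositive Δ → (π : Params) → InC Δ π →
           ((f123 (Γ Δ π) ≡ f1 Δ * f23 Δ) ⇔ (f23 Δ ≤ fdiv (f12 Δ) (f1 Δ) * fdiv (f13 Δ) (f1 Δ)))
           × ((f123 (Γ Δ π) ≡ f2 Δ * f13 Δ) ⇔ (f13 Δ ≤ fdiv (f12 Δ) (f2 Δ) * fdiv (f23 Δ) (f2 Δ)))
           × ((f123 (Γ Δ π) ≡ f3 Δ * f12 Δ) ⇔ (f12 Δ ≤ fdiv (f13 Δ) (f3 Δ) * fdiv (f23 Δ) (f3 Δ)))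
lemma2p9 Δ pos@(f1>0 , f2>0 , f3>0 , f12>0 , f13>0 , f23>0 , _) π
         (((_ , _ , _ , v₁ , v₂ , v₃ , e₁₂ , e₁₃ , e₂₃) , maximal) , _) =
  case G refl f1>0 f23>0 v₁ e₂₃ e₁₂ e₁₃ (achievable₁ Δ pos) ,
  case (swap₁₂ G) (f123-swap₁₂ G) f2>0 f13>0 v₂ e₁₃ (subst (_≤ f12 Δ) (sym (f12-swap₁₂ G)) e₁₂) e₂₃
       (achievable₂ Δ pos) ,
  case (rotate G) (f123-rotate G) f3>0 f12>0 v₃ e₁₂ (subst (_≤ f13 Δ) (sym (f12-rotate G)) e₁₃)
       (subst (_≤ f23 Δ) (sym (f13-rotate G)) e₂₃) (achievable₃ Δ pos)
  where
  G : Complex3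
  G = Γ Δ π
  -- Only the facet-maximality of ℬ(Δ) is needed, not the edge-maximality of 𝒞(Δ).
  case : ∀ K {F E A B} → f123 K ≡ f123 G → 1 ≤ F → 1 ≤ E → f1 K ≤ F → f23 K ≤ E → f12 K ≤ A → f13 K ≤ B →
         (E ≤ fdiv A F * fdiv B F → Achievable Δ (F * E)) →
         (f123 G ≡ F * E) ⇔ (E ≤ fdiv A F * fdiv B F)
  case K {F} {E} K≅G F>0 E>0 f1≤ f23≤ f12≤ f13≤ achieve =
    subst (λ s → (s ≡ F * E) ⇔ _) K≅G (f123≡F*E⇔ K F>0 E>0 f1≤ f23≤ f12≤ f13≤ λ bound →
      let (π′ , π′∈A , F*E≤) = achieve bound in subst (F * E ≤_) (sym K≅G) (≤-trans F*E≤ (maximal π′ π′∈A)))
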